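{- Let $k$ be a positive integer, $G$ a $k$-tree, and $L$ a simplicial ordering of $V(G)$. Then for every $v\in V(G)$, $\operatorname{Reach}_1[G,L,v]=\operatorname{Reach}_\infty[G,L,v]$.
   Context: A $k$-tree is a clique of order $k+1$ or a graph obtained from a smaller $k$-tree by adding a new vertex adjacent to $k$ pairwise adjacent vertices. A simplicial ordering $L$ of a $k$-tree $G$ is obtained by fixing a construction of $G$ from an initial $(k+1)$-clique $K_0$, placing the vertices of $K_0$ first, and for $u,v\notin K_0$ letting $u<_L v$ iff $u$ was added before $v$. For a linear ordering $L$, $\ell\in\mathbb N\cup\{\infty\}$ and $v\in V(G)$, $\operatorname{Reach}_\ell[G,L,v]$ is the set of vertices $u\le_L v$ for which there is a path $x_0x_1\dots x_s$ with $x_0=v$, $x_s=u$, $s\le\ell$, and $u<_L x_{i-1}$ for every $i\in\{1,\dots,s\}$ and all internal vertices $x_1,\dots,x_{s-1}$ satisfy $v<_L x_i$ (i.e. $u$ is the only vertex of the path other than $v$ that is $L$-smaller than $v$); in particular $v\in\operatorname{Reach}_\ell[G,L,v]$. -}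

module Defs where

open import Data.Nat using (ℕ; suc; _≤_; _<_; _+_)
open import Data.Fin using (Fin; toℕ)
import Data.Fin as F
open import Data.List using (List; []; _∷_; _∷ʳ_; length)
open import Data.List.Membership.Propositional using (_∈_)
open import Data.List.Relation.Unary.All using (All)
open import Data.List.Relation.Unary.Unique.Propositional using (Unique)
open import Data.List.Relation.Unary.Linked using (Linked)
open import Data.Product using (Σ; _×_; ∃)
open import Data.Sum using (_⊎_)
open import Data.Unit using (⊤)
open import Relation.Nullary using (¬_)
open import Relation.Binary.PropositionalEquality using (_≡_; _≢_)
open import Function.Definitions using (Injective)

record Graph (n : ℕ) : Set₁ where
  field
    Adj    : Fin n → Fin n → Set
    sym    : ∀ {u v} → Adj u v → Adj v u
    irrefl : ∀ {u} → ¬ Adj u u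
open Graph public using (Adj)

record LinOrd (n : ℕ) : Set where
  field
    pos     : Fin n → Fin n
    pos-inj : Injective _≡_ _≡_ pos
open LinOrd public



_<_at_ : ∀ {n} → Fin n → Fin n → LinOrd n → Set
u < v at L = pos L u F.< pos L v

_≤_at_ : ∀ {n} → Fin n → Fin n → LinOrd n → Set
u ≤ v at L = pos L u F.≤ pos L v

-- "G is a k-tree and L is a simplicial ordering of G":
-- there is a construction of G from an initial (k+1)-clique K₀ in which the
-- vertices are added in the order L.
record SimplicialKTree (k n : ℕ) (G : Graph n) (L : LinOrd n) : Set where
  field
    size     : suc k ≤ n
    clique₀  : ∀ u w → toℕ (pos L u) ≤ k → toℕ (pos L w) ≤ k → u ≢ w →
               Adj G u w
    attach   : ∀ v → k < toℕ (pos L v) →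
               Σ (List (Fin n)) λ C →
                 (length C ≡ k) × Unique C ×
                 All (λ x → x < v at L) C ×
                 All (λ x → Adj G x v) C ×
                 (∀ x y → x ∈ C → y ∈ C → x ≢ y → Adj G x y) ×
                 (∀ u → u < v at L → Adj G u v → u ∈ C)

data Bound : Set where
  fin : ℕ → Bound
  ∞   : Bound

_≤B_ : ℕ → Bound → Set
s ≤B fin ℓ = s ≤ ℓ
s ≤B ∞     = ⊤

-- A reaching path from v to u of length s = length mid + 1:
-- the path v, x₁, …, x_{s-1}, u  (mid = x₁ … x_{s-1}), simple, consecutive
-- vertices adjacent, u L-smaller than every vertex before it on the path,
-- and all internal vertices L-larger than v.
ReachPath : ∀ {n} → Graph n → LinOrd n → Bound → Fin n → Fin n → List (Fin n) → Set
ReachPath G L ℓ v u mid =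
  Linked (Adj G) (v ∷ mid ∷ʳ u) ×
  Unique (v ∷ mid ∷ʳ u) ×
  (suc (length mid) ≤B ℓ) ×
  All (λ x → u < x at L) (v ∷ mid) ×
  All (λ x → v < x at L) mid

-- u ∈ Reach_ℓ[G, L, v]   (the length-0 path gives v ∈ Reach_ℓ[G,L,v])
InReach : ∀ {n} → Graph n → LinOrd n → Bound → Fin n → Fin n → Set
InReach G L ℓ v u =
  (u ≤ v at L) × ((u ≡ v) ⊎ ∃ (λ mid → ReachPath G L ℓ v u mid))

-- In a simplicial ordering the L-earlier neighbours of any vertex form a clique.
-- Hence on a walk whose inner vertices lie above both ends, the first local
-- L-maximum among the inner vertices can be cut out: its two walk-neighbours are
-- earlier neighbours of it, so they are equal or adjacent.  Repeating this
-- leaves a single edge, so every vertex reachable from v is reachable in one step.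
module Submission where

open import Defs
open import Data.Nat using (ℕ; _≤_; suc; s≤s; z≤n)
open import Data.Nat.Properties using (≤-refl; ≤-trans; n≤1+n; <⇒≤; ≮⇒≥; _<?_)
open import Data.Fin using (Fin; toℕ)
open import Data.Fin.Properties using (_≟_; <-cmp; <-irrefl)
open import Data.Product using (_×_; ∃; _,_; map₂)
import Data.Sum as Sum
open import Data.List using (List; []; _∷_; _∷ʳ_; length)
open import Data.List.Relation.Binary.Subset.Propositional using (_⊆_)
open import Data.List.Relation.Unary.All using (All; []; _∷_)
open import Data.List.Relation.Unary.All.Properties using (anti-mono)
open import Data.List.Relation.Unary.Any using (here; there)
open import Data.List.Relation.Unary.AllPairs using ([]; _∷_)
open import Data.List.Relation.Unary.Linked using (Linked; [-]; _∷_)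
open import Relation.Binary.PropositionalEquality using (_≢_; refl)
open import Relation.Binary.Definitions using (tri<; tri≈; tri>)
open import Relation.Nullary using (yes; no)
open import Data.Empty using (⊥-elim)
open import Data.Unit using (tt)
open import Function using (_∘_)

Above : ∀ {n} → LinOrd n → Fin n → List (Fin n) → Set
Above L b = All (λ x → b < x at L)

module _ {k n : ℕ} {G : Graph n} {L : LinOrd n} (T : SimplicialKTree k n G L) where
  open SimplicialKTree T

  earlierNeighbours-adjacent : ∀ {w a b} → a < w at L → b < w at L →
    Adj G a w → Adj G b w → a ≢ b → Adj G a b
  earlierNeighbours-adjacent {w} {a} {b} a<w b<w aw bw a≢b with k <? toℕ (pos L w)
  ... | yes k<w with attach w k<w
  ...   | _ , _ , _ , _ , _ , C-clique , earlier⊆C =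
    C-clique a b (earlier⊆C a a<w aw) (earlier⊆C b b<w bw) a≢b
  earlierNeighbours-adjacent a<w b<w _ _ a≢b | no k≮w =
    clique₀ _ _ (≤-trans (<⇒≤ a<w) w≤k) (≤-trans (<⇒≤ b<w) w≤k) a≢b
    where w≤k = ≮⇒≥ k≮w

  removePeak : ∀ {a x b} xs → a ≢ b → a < x at L → Above L b (x ∷ xs) →
    Linked (Adj G) (a ∷ x ∷ xs ∷ʳ b) →
    ∃ λ ys → length ys ≤ length xs × ys ⊆ x ∷ xs × Linked (Adj G) (a ∷ ys ∷ʳ b)
  removePeak [] a≢b a<x (b<x ∷ []) (ax ∷ xb ∷ [-]) =
    [] , z≤n , (λ ()) , earlierNeighbours-adjacent a<x b<x ax (Graph.sym G xb) a≢b ∷ [-]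
  removePeak {a} {x} (y ∷ ys) a≢b a<x (b<x ∷ b<y∷ys) (ax ∷ xy ∷ walk)
    with <-cmp (pos L x) (pos L y)
  ... | tri< x<y _ _ =
    let zs , shorter , zs⊆ , walk′ =
          removePeak ys (λ { refl → <-irrefl refl b<x }) x<y b<y∷ys (xy ∷ walk)
    in x ∷ zs , s≤s shorter , (λ { (here e) → here e ; (there p) → there (zs⊆ p) }) , ax ∷ walk′
  ... | tri≈ _ x≡y _ rewrite pos-inj L x≡y = ⊥-elim (Graph.irrefl G xy)
  ... | tri> _ _ y<x with a ≟ y
  ...   | yes refl = ys , n≤1+n _ , there ∘ there , walk
  ...   | no a≢y   =
    y ∷ ys , ≤-refl , there , earlierNeighbours-adjacent a<x y<x ax (Graph.sym G xy) a≢y ∷ walk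

  walkAbove⇒adjacent : ∀ {a b} mid → a ≢ b → Above L a mid → Above L b mid →
    Linked (Adj G) (a ∷ mid ∷ʳ b) → Adj G a b
  walkAbove⇒adjacent mid = go (length mid) mid ≤-refl
    where
    go : ∀ m {a b} mid → length mid ≤ m → a ≢ b → Above L a mid → Above L b mid →
      Linked (Adj G) (a ∷ mid ∷ʳ b) → Adj G a b
    go _ [] _ _ _ _ (ab ∷ [-]) = ab
    go (suc m) (x ∷ xs) (s≤s len) a≢b (a<x ∷ a<xs) b<x∷xs walk =
      let ys , shorter , ys⊆ , walk′ = removePeak xs a≢b a<x b<x∷xs walk
      in go m ys (≤-trans shorter len) a≢b
            (anti-mono ys⊆ (a<x ∷ a<xs)) (anti-mono ys⊆ b<x∷xs) walk′

  reachPath⇒adjacent : ∀ {ℓ v u} mid → ReachPath G L ℓ v u mid → Adj G v u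
  reachPath⇒adjacent mid (walk , _ , _ , u<v ∷ u<mid , v<mid) =
    walkAbove⇒adjacent mid (λ { refl → <-irrefl refl u<v }) v<mid u<mid walk

module _ {n : ℕ} (G : Graph n) (L : LinOrd n) where

  reachPath-unbounded : ∀ {ℓ v u mid} → ReachPath G L ℓ v u mid → ReachPath G L ∞ v u mid
  reachPath-unbounded (walk , unique , _ , u<v∷mid , v<mid) =
    walk , unique , tt , u<v∷mid , v<mid

  edge⇒reachPath : ∀ {v u} → u < v at L → Adj G v u → ReachPath G L (fin 1) v u []
  edge⇒reachPath u<v vu = vu ∷ [-] , (v≢u ∷ []) ∷ [] ∷ [] , s≤s z≤n , u<v ∷ [] , []
    where
    v≢u : _ ≢ _
    v≢u refl = <-irrefl refl u<v

-- The argument does not need k ≥ 1.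
mainTheorem10 : (k n : ℕ) → 1 ≤ k → (G : Graph n) → (L : LinOrd n) →
    SimplicialKTree k n G L → (v u : Fin n) →
    (InReach G L (fin 1) v u → InReach G L ∞ v u) ×
    (InReach G L ∞ v u → InReach G L (fin 1) v u)
mainTheorem10 _ _ _ G L T v u =
  map₂ (Sum.map₂ λ { (mid , path) → mid , reachPath-unbounded G L path }) ,
  map₂ (Sum.map₂ λ { (mid , path) → [] , shortcut mid path })
  where
  shortcut : ∀ mid → ReachPath G L ∞ v u mid → ReachPath G L (fin 1) v u []
  shortcut mid path@(_ , _ , _ , u<v ∷ _ , _) =
    edge⇒reachPath G L u<v (reachPath⇒adjacent T mid path)
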